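{- Let $T$ denote the map on odd positive integers $T(n)=(3n+1)/2^{\nu}$, where $2^\nu$ is the largest power of $2$ dividing $3n+1$. For every even integer $p\geq 0$, one has $T\big(T(2\cdot 3^{p}-1)\big)=T(2\cdot 3^{p+1}-1)$; moreover the first application of $T$ to $2\cdot 3^p-1$ divides by exactly $2^2$, and $T\big(T(2\cdot 3^{p}-1)\big)=\dfrac{3^{p+2}-1}{2^{r+1}}$, where $r\geq 2$ is the exponent such that $T\big(T(2\cdot 3^p-1)\big)=\big(3\,T(2\cdot 3^p-1)+1\big)/2^{r}$, while the application of $T$ to $2\cdot 3^{p+1}-1$ divides by exactly $2^{r+2}$.
   Context: In the paper's notation, $G_{u(p)+1}(x)=x(x+1)^p-1$ with $x\equiv 2$, i.e. $G_{u(p)+1}=2\cdot 3^p-1$, and the Collatz operation is $C_q[n]=(3n+1)/2^q$ with $q$ maximal; the statement is $C_{r+2}[G_{u(p+1)+1}]=C_r[C_2[G_{u(p)+1}]]$ for $p=0,2,4,\dots$. -}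

module Defs where

open import Data.Nat using (ℕ; suc; _+_; _*_; _^_)
open import Data.Nat.Divisibility using (_∣_)
open import Data.Product using (_×_)
open import Relation.Binary.PropositionalEquality using (_≡_)
open import Relation.Nullary using (¬_)

LargestPow2 : ℕ → ℕ → Set
LargestPow2 ν x = (2 ^ ν ∣ x) × ¬ (2 ^ suc ν ∣ x)

-- CollatzStep n ν m :  T(n) = m, where T(n) = (3n+1)/2^ν with 2^ν the
-- largest power of 2 dividing 3n+1 (the paper's C_ν[n] = m).
CollatzStep : ℕ → ℕ → ℕ → Set
CollatzStep n ν m = LargestPow2 ν (3 * n + 1) × (3 * n + 1 ≡ 2 ^ ν * m)

module Submission where

-- Write p = 2k and s = 3^p = 9^k, so s ≡ 1 (mod 8), say s = 1 + 8c.
-- Then 2s - 1 = 1 + 16c and 3(2s - 1) + 1 = 4(1 + 12c), where a = 1 + 12c is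
-- odd; so T divides 2s - 1 by exactly 2^2 and T(2s - 1) = a.  Next,
-- 3a + 1 = 4(1 + 9c); writing 1 + 9c = 2^e·b with b odd, T(a) = b with
-- exponent r = e + 2 ≥ 2.  On the other side 3(2·3s - 1) + 1 = 16(1 + 9c)
-- = 2^(r+2)·b, so T(2·3^(p+1) - 1) = b as well, and 2^(r+1)·b = 8(1 + 9c)
-- = 9s - 1 = 3^(p+2) - 1.

open import Defs
open import Data.Nat using (ℕ; zero; suc; _+_; _*_; _^_; _∸_; _≥_; _<_; s≤s)
open import Data.Nat.Divisibility using (_∣_; divides; m∣m*n; *-cancelˡ-∣; ∣m+n∣m⇒∣n; ∣1⇒≡1)
open import Data.Nat.Induction using (<-rec)
open import Data.Nat.Properties using (+-comm; +-assoc; +-identityʳ; *-assoc; *-comm; m≤m+n; m≤n+m; *-distribˡ-+; ^-distribˡ-+-*)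
open import Data.Nat.Tactic.RingSolver using (solve-∀)
open import Data.Product using (_×_; _,_; ∃-syntax)
open import Data.Sum using (_⊎_; inj₁; inj₂)
open import Relation.Binary.PropositionalEquality using (_≡_; refl; sym; trans; cong; subst; module ≡-Reasoning)
open import Relation.Nullary using (¬_)

open ≡-Reasoning

two∤odd : ∀ j → ¬ (2 ∣ 1 + 2 * j)
two∤odd j 2∣odd with ∣1⇒≡1 (∣m+n∣m⇒∣n (subst (2 ∣_) (+-comm 1 (2 * j)) 2∣odd) (m∣m*n j))
... | ()

largestPow2-odd : ∀ ν j → LargestPow2 ν (2 ^ ν * (1 + 2 * j))
largestPow2-odd ν j = m∣m*n _ , not-divisible ν
  where
    not-divisible : ∀ ν → ¬ (2 ^ suc ν ∣ 2 ^ ν * (1 + 2 * j))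
    not-divisible zero    d = two∤odd j (subst (2 ∣_) (+-comm (1 + 2 * j) 0) d)
    not-divisible (suc ν) d =
      not-divisible ν (*-cancelˡ-∣ 2 (subst (2 ^ suc (suc ν) ∣_) (*-assoc 2 (2 ^ ν) _) d))

collatzStep-intro : ∀ n ν j → 3 * n + 1 ≡ 2 ^ ν * (1 + 2 * j) → CollatzStep n ν (1 + 2 * j)
collatzStep-intro n ν j eq = subst (LargestPow2 ν) (sym eq) (largestPow2-odd ν j) , eq

parity : ∀ n → ∃[ j ] (n ≡ 2 * j ⊎ n ≡ 1 + 2 * j)
parity zero = 0 , inj₁ refl
parity (suc zero) = 0 , inj₂ refl
parity (suc (suc n)) with parity n
... | j , inj₁ even = suc j , inj₁ (trans (cong (2 +_) even) (sym (*-distribˡ-+ 2 1 j)))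
... | j , inj₂ odd  = suc j , inj₂ (trans (cong (2 +_) odd) (cong suc (sym (*-distribˡ-+ 2 1 j))))

OddPart : ℕ → Set
OddPart n = ∃[ e ] ∃[ j ] (n ≡ 2 ^ e * (1 + 2 * j))

oddPart : ∀ n → OddPart (suc n)
oddPart = <-rec (λ n → OddPart (suc n)) split
  where
    split : ∀ n → (∀ {m} → m < n → OddPart (suc m)) → OddPart (suc n)
    split n rec with parity n
    ... | j , inj₁ refl = 0 , j , sym (+-identityʳ _)
    ... | j , inj₂ refl with rec {j} (s≤s (m≤m+n j (j + 0)))
    ...   | e , i , eq = suc e , i , (begin
      2 + 2 * j                ≡⟨ sym (*-distribˡ-+ 2 1 j) ⟩
      2 * suc j                ≡⟨ cong (2 *_) eq ⟩
      2 * (2 ^ e * (1 + 2 * i)) ≡⟨ sym (*-assoc 2 (2 ^ e) _) ⟩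
      2 ^ suc e * (1 + 2 * i)  ∎)

-- Even powers of 3 are ≡ 1 (mod 8), because 9 ≡ 1 (mod 8).
threePow-even : ∀ k → ∃[ c ] (3 ^ (k * 2) ≡ 1 + 8 * c)
threePow-even zero = 0 , refl
threePow-even (suc k) with threePow-even k
... | c , eq = 1 + 9 * c , trans (cong (λ t → 3 * (3 * t)) eq) (nine-times c)
  where
    nine-times : ∀ c → 3 * (3 * (1 + 8 * c)) ≡ 1 + 8 * (1 + 9 * c)
    nine-times = solve-∀

pow2-combine : ∀ e k m → 2 ^ k * (2 ^ e * m) ≡ 2 ^ (e + k) * m
pow2-combine e k m = begin
  2 ^ k * (2 ^ e * m) ≡⟨ sym (*-assoc (2 ^ k) (2 ^ e) m) ⟩
  2 ^ k * 2 ^ e * m   ≡⟨ cong (_* m) (*-comm (2 ^ k) (2 ^ e)) ⟩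
  2 ^ e * 2 ^ k * m   ≡⟨ cong (_* m) (sym (^-distribˡ-+-* 2 e k)) ⟩
  2 ^ (e + k) * m     ∎

collatz-doubleMinusOne : ∀ x → 3 * (2 * suc x ∸ 1) + 1 ≡ 2 * (3 * x + 2)
collatz-doubleMinusOne x = begin
  3 * (2 * suc x ∸ 1) + 1 ≡⟨ cong (λ t → 3 * (t ∸ 1) + 1) (*-distribˡ-+ 2 1 x) ⟩
  3 * (1 + 2 * x) + 1     ≡⟨ regroup x ⟩
  2 * (3 * x + 2)         ∎
  where
    regroup : ∀ x → 3 * (1 + 2 * x) + 1 ≡ 2 * (3 * x + 2)
    regroup = solve-∀

-- The theorem for an arbitrary s ≡ 1 (mod 8) in place of 3^p: with
-- s = 1 + 8c and 1 + 9c = 2^e·b (b odd), T(2s - 1) = 1 + 12c with exponent 2,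
-- T(1 + 12c) = b with exponent r = e + 2, T(6s - 1) = b with exponent r + 2,
-- and 2^(r+1)·b = 9s - 1.
trajectory : ∀ s c → s ≡ 1 + 8 * c →
  ∃[ a ] ∃[ b ] ∃[ r ]
    ( CollatzStep (2 * s ∸ 1) 2 a
    × CollatzStep a r b
    × r ≥ 2
    × CollatzStep (2 * (s * 3) ∸ 1) (r + 2) b
    × 2 ^ (r + 1) * b ≡ s * 9 ∸ 1 )
trajectory s c refl with oddPart (9 * c)
... | e , j , 1+9c≡ =
  1 + 2 * (6 * c) , b , e + 2 ,
  collatzStep-intro (2 * (1 + 8 * c) ∸ 1) 2 (6 * c) first ,
  collatzStep-intro (1 + 2 * (6 * c)) (e + 2) j second ,
  m≤n+m 2 e ,
  collatzStep-intro (2 * ((1 + 8 * c) * 3) ∸ 1) (e + 2 + 2) j third ,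
  closing
  where
    b = 1 + 2 * j

    first : 3 * (2 * (1 + 8 * c) ∸ 1) + 1 ≡ 2 ^ 2 * (1 + 2 * (6 * c))
    first = trans (collatz-doubleMinusOne (8 * c)) (regroup c)
      where
        regroup : ∀ c → 2 * (3 * (8 * c) + 2) ≡ 4 * (1 + 2 * (6 * c))
        regroup = solve-∀

    second : 3 * (1 + 2 * (6 * c)) + 1 ≡ 2 ^ (e + 2) * b
    second = begin
      3 * (1 + 2 * (6 * c)) + 1 ≡⟨ regroup c ⟩
      2 ^ 2 * (1 + 9 * c)       ≡⟨ cong (2 ^ 2 *_) 1+9c≡ ⟩
      2 ^ 2 * (2 ^ e * b)       ≡⟨ pow2-combine e 2 b ⟩
      2 ^ (e + 2) * b           ∎
      where
        regroup : ∀ c → 3 * (1 + 2 * (6 * c)) + 1 ≡ 4 * (1 + 9 * c)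
        regroup = solve-∀

    third : 3 * (2 * ((1 + 8 * c) * 3) ∸ 1) + 1 ≡ 2 ^ (e + 2 + 2) * b
    third = begin
      3 * (2 * ((1 + 8 * c) * 3) ∸ 1) + 1 ≡⟨ collatz-doubleMinusOne (2 + 8 * c * 3) ⟩
      2 * (3 * (2 + 8 * c * 3) + 2)       ≡⟨ regroup c ⟩
      2 ^ 4 * (1 + 9 * c)                 ≡⟨ cong (2 ^ 4 *_) 1+9c≡ ⟩
      2 ^ 4 * (2 ^ e * b)                 ≡⟨ pow2-combine e 4 b ⟩
      2 ^ (e + 4) * b                     ≡⟨ cong (λ t → 2 ^ t * b) (sym (+-assoc e 2 2)) ⟩
      2 ^ (e + 2 + 2) * b                 ∎
      where
        regroup : ∀ c → 2 * (3 * (2 + 8 * c * 3) + 2) ≡ 16 * (1 + 9 * c)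
        regroup = solve-∀

    closing : 2 ^ (e + 2 + 1) * b ≡ (1 + 8 * c) * 9 ∸ 1
    closing = begin
      2 ^ (e + 2 + 1) * b ≡⟨ cong (λ t → 2 ^ t * b) (+-assoc e 2 1) ⟩
      2 ^ (e + 3) * b     ≡⟨ sym (pow2-combine e 3 b) ⟩
      2 ^ 3 * (2 ^ e * b) ≡⟨ cong (2 ^ 3 *_) (sym 1+9c≡) ⟩
      2 ^ 3 * (1 + 9 * c) ≡⟨ regroup c ⟩
      8 + 8 * c * 9       ∎
      where
        regroup : ∀ c → 8 * (1 + 9 * c) ≡ 8 + 8 * c * 9
        regroup = solve-∀

mainTheorem4 : (p : ℕ) → 2 ∣ p →
    ∃[ a ] ∃[ b ] ∃[ r ]
    ( CollatzStep (2 * 3 ^ p ∸ 1) 2 a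
    × CollatzStep a r b
    × r ≥ 2
    × CollatzStep (2 * 3 ^ (p + 1) ∸ 1) (r + 2) b
    × 2 ^ (r + 1) * b ≡ 3 ^ (p + 2) ∸ 1 )
mainTheorem4 p (divides k refl) with threePow-even k
... | c , 3^p≡1+8c
  rewrite ^-distribˡ-+-* 3 (k * 2) 1 | ^-distribˡ-+-* 3 (k * 2) 2
  = trajectory (3 ^ (k * 2)) c 3^p≡1+8c
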